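{- Let $G$ be a multigraph. If $L(G)$ has a stable cut, then $G$ has a multigraph matching cut. If $G$ has a multigraph matching cut and every vertex of $G$ is incident to at least $2$ edges, then $L(G)$ has a stable cut.
   Context: A multigraph is a finite loopless graph in which parallel edges are allowed. A multigraph matching cut of $G$ is a partition of $V(G)$ into two nonempty sets $A,B$ such that every vertex is incident to at most one edge (edges counted with multiplicity) joining $A$ and $B$. The line graph $L(G)$ of a multigraph $G$ is the simple loopless graph with one vertex for each edge of $G$ (parallel edges giving distinct vertices), two distinct vertices being adjacent when the corresponding edges share at least one endpoint. A stable cut of a simple loopless graph $F$ is an independent set $C\subseteq V(F)$ such that $F-C$ is disconnected. -}

module Defs where

open import Data.Nat using (ℕ)
open import Data.Fin using (Fin)
open import Data.Bool using (Bool; true; false)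
open import Data.Product using (Σ; ∃; ∃-syntax; _×_; _,_)
open import Data.Sum using (_⊎_)
open import Relation.Nullary using (¬_)
open import Relation.Binary.PropositionalEquality using (_≡_; _≢_)

-- A finite loopless multigraph: vertices Fin n, edges Fin m (distinct edge
-- indices may have the same endpoints, i.e. parallel edges are allowed).
record Multigraph : Set where
  field
    n       : ℕ
    m       : ℕ
    src     : Fin m → Fin n
    tgt     : Fin m → Fin n
    loopless : ∀ e → src e ≢ tgt e

module _ (G : Multigraph) where
  open Multigraph G

  Incident : Fin m → Fin n → Set
  Incident e v = (src e ≡ v) ⊎ (tgt e ≡ v)

  Crosses : (Fin n → Bool) → Fin m → Set
  Crosses side e = side (src e) ≢ side (tgt e)

  -- A = {v | side v ≡ true}, B = {v | side v ≡ false}, both nonempty, and each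
  -- vertex is incident to at most one edge (with multiplicity) joining A and B.
  IsMatchingCut : (Fin n → Bool) → Set
  IsMatchingCut side =
    (∃[ a ] side a ≡ true) × (∃[ b ] side b ≡ false) ×
    (∀ v e f → Incident e v → Incident f v →
       Crosses side e → Crosses side f → e ≡ f)

  HasMatchingCut : Set
  HasMatchingCut = ∃[ side ] IsMatchingCut side

  MinIncidence2 : Set
  MinIncidence2 = ∀ v → ∃[ e ] ∃[ f ] (e ≢ f × Incident e v × Incident f v)

record SimpleGraph : Set₁ where
  field
    k       : ℕ
    Adj     : Fin k → Fin k → Set
    Adj-sym : ∀ {x y} → Adj x y → Adj y x
    Adj-irr : ∀ {x} → ¬ Adj x x

LineGraph : Multigraph → SimpleGraph
LineGraph G = record
  { k = Multigraph.m G
  ; Adj = λ e f → e ≢ f × ∃[ v ] (Incident G e v × Incident G f v)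
  ; Adj-sym = λ { (e≢f , v , ie , if) → (λ p → e≢f (sym' p)) , v , if , ie }
  ; Adj-irr = λ { (e≢e , _) → e≢e reflP }
  }
  where
  open import Relation.Binary.PropositionalEquality using () renaming (sym to sym' ; refl to reflP)

module _ (F : SimpleGraph) where
  open SimpleGraph F

  -- Paths in F - C (C given by its indicator; vertices in C are `true`).
  -- Path C x y: a walk x = x0, x1, ..., xr = y in F all of whose vertices
  -- after the first avoid C (the first one is required to avoid C separately).
  data PathAvoiding (C : Fin k → Bool) : Fin k → Fin k → Set where
    here : ∀ x → PathAvoiding C x x
    step : ∀ {x y z} → Adj x y → C y ≡ false → PathAvoiding C y z →
           PathAvoiding C x z

  Independent : (Fin k → Bool) → Set
  Independent C = ∀ x y → C x ≡ true → C y ≡ true → ¬ Adj x y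

  DisconnectedWithout : (Fin k → Bool) → Set
  DisconnectedWithout C =
    ∃[ x ] ∃[ y ] (C x ≡ false × C y ≡ false × ¬ PathAvoiding C x y)

  IsStableCut : (Fin k → Bool) → Set
  IsStableCut C = Independent C × DisconnectedWithout C

  HasStableCut : Set
  HasStableCut = ∃[ C ] IsStableCut C

-- A stable cut C of L(G) separating two edges x, y becomes a matching cut of G by
-- putting on one side the vertices touched by edges reachable from x in L(G) − C:
-- an edge outside C that touches such a vertex is itself reachable, so only
-- edges of C cross, and two crossing edges at a common vertex would be adjacent
-- members of the independent set C.  Conversely, the crossing edges of a matching
-- cut are pairwise non-adjacent, every non-crossing edge lies inside one side, and
-- adjacent non-crossing edges lie inside the same side; with minimum degree 2,
-- each side contains a non-crossing edge, and no path in L(G) − C joins them.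
module Submission where

open import Defs
open import Level using (Level)
open import Data.Nat using (ℕ)
open import Data.Fin using (Fin; _≟_)
open import Data.Fin.Properties using (any?)
open import Data.Fin.Subset using (Subset; _∈_; _∉_; _⊃_; _∪_; ⁅_⁆)
open import Data.Fin.Subset.Properties using (_∈?_; p⊆p∪q; x∈p∪q⁺; x∈p∪q⁻; x∈⁅x⁆; x∈⁅y⁆⇒x≡y)
open import Data.Fin.Subset.Induction using (Acc; acc; ⊃-wellFounded)
open import Data.Bool using (Bool; true; false)
import Data.Bool.Properties as Bool
open import Data.Product using (_×_; _,_; ∃-syntax; ∃₂)
open import Data.Sum using (_⊎_; inj₁; inj₂)
open import Data.Empty using (⊥-elim)
open import Function.Bundles using (_⇔_; mk⇔)
open import Relation.Nullary using (¬_; Dec; yes; no; does; contradiction)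
open import Relation.Nullary.Decidable
  using (_×-dec_; _⊎-dec_; ¬?; dec-true; dec-false; decidable-stable)
import Relation.Nullary.Decidable as Dec
open import Relation.Binary using (Rel; Decidable)
open import Relation.Binary.Construct.Closure.ReflexiveTransitive using (Star; ε; _◅_; _◅◅_)
open import Relation.Binary.PropositionalEquality using (_≡_; refl; sym; trans; module ≡-Reasoning)

private
  variable
    a ℓ : Level
    A : Set a

does≡true⇒ : (A? : Dec A) → does A? ≡ true → A
does≡true⇒ (yes x) _ = x

does≡false⇒¬ : (A? : Dec A) → does A? ≡ false → ¬ A
does≡false⇒¬ (no ¬x) _ = ¬x

module FiniteReachability {k : ℕ} {R : Rel (Fin k) ℓ} (R? : Decidable R) where

  Closed : Subset k → Set ℓ
  Closed p = ∀ {u v} → u ∈ p → R u v → v ∈ p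

  closed⊎exit : (p : Subset k) →
    Closed p ⊎ ∃₂ λ u v → u ∈ p × R u v × v ∉ p
  closed⊎exit p with any? (λ u → any? (λ v → u ∈? p ×-dec R? u v ×-dec ¬? (v ∈? p)))
  ... | yes (u , v , u∈p , r , v∉p) = inj₂ (u , v , u∈p , r , v∉p)
  ... | no noExit = inj₁ λ {u} {v} u∈p r →
    decidable-stable (v ∈? p) λ v∉p → noExit (u , v , u∈p , r , v∉p)

  closed⇒Star⊆ : ∀ {p x y} → Closed p → x ∈ p → Star R x y → y ∈ p
  closed⇒Star⊆ closed x∈p ε        = x∈p
  closed⇒Star⊆ closed x∈p (r ◅ rs) = closed⇒Star⊆ closed (closed x∈p r) rs

  saturate : ∀ {x} p → Acc _⊃_ p → x ∈ p → (∀ {y} → y ∈ p → Star R x y) →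
    ∃[ q ] (x ∈ q × Closed q × (∀ {y} → y ∈ q → Star R x y))
  saturate {x} p (acc larger) x∈p reached with closed⊎exit p
  ... | inj₁ closed = p , x∈p , closed , reached
  ... | inj₂ (u , v , u∈p , r , v∉p) =
    saturate (p ∪ ⁅ v ⁆) (larger p⊂p∪⁅v⁆) (p⊆p∪q _ x∈p) reached′
    where
    p⊂p∪⁅v⁆ : (p ∪ ⁅ v ⁆) ⊃ p
    p⊂p∪⁅v⁆ = p⊆p∪q _ , v , x∈p∪q⁺ (inj₂ (x∈⁅x⁆ v)) , v∉p

    reached′ : ∀ {y} → y ∈ p ∪ ⁅ v ⁆ → Star R x y
    reached′ y∈ with x∈p∪q⁻ p ⁅ v ⁆ y∈
    ... | inj₁ y∈p = reached y∈p
    ... | inj₂ y∈⁅v⁆ rewrite x∈⁅y⁆⇒x≡y v y∈⁅v⁆ = reached u∈p ◅◅ r ◅ ε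

  reachableSet : ∀ x → ∃[ q ] (∀ y → y ∈ q ⇔ Star R x y)
  reachableSet x =
    let (q , x∈q , closed , reached) =
          saturate ⁅ x ⁆ (⊃-wellFounded _) (x∈⁅x⁆ x) reachedFromSingleton
    in  q , λ y → mk⇔ reached (closed⇒Star⊆ closed x∈q)
    where
    reachedFromSingleton : ∀ {y} → y ∈ ⁅ x ⁆ → Star R x y
    reachedFromSingleton y∈ rewrite x∈⁅y⁆⇒x≡y x y∈ = ε

  reachable? : Decidable (Star R)
  reachable? x y with reachableSet x
  ... | q , q≡reach = Dec.map (q≡reach y) (y ∈? q)

module _ (F : SimpleGraph) where
  open SimpleGraph F

  AvoidingStep : (Fin k → Bool) → Rel (Fin k) _
  AvoidingStep C u v = Adj u v × C v ≡ false

  Star⇒PathAvoiding : ∀ {C x y} → Star (AvoidingStep C) x y → PathAvoiding F C x y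
  Star⇒PathAvoiding ε               = here _
  Star⇒PathAvoiding ((uv , Cv) ◅ r) = step uv Cv (Star⇒PathAvoiding r)

  PathAvoiding-preserves : ∀ {C x y} (f : Fin k → A) →
    (∀ {u v} → Adj u v → C u ≡ false → C v ≡ false → f u ≡ f v) →
    PathAvoiding F C x y → C x ≡ false → f x ≡ f y
  PathAvoiding-preserves f adj⇒≡ (here _)          Cx = refl
  PathAvoiding-preserves f adj⇒≡ (step xz Cz path) Cx =
    trans (adj⇒≡ xz Cx Cz) (PathAvoiding-preserves f adj⇒≡ path Cz)

module _ (G : Multigraph) where
  open Multigraph G

  private
    L : SimpleGraph
    L = LineGraph G

  incident? : ∀ e v → Dec (Incident G e v)
  incident? e v = (src e ≟ v) ⊎-dec (tgt e ≟ v)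

  lineAdjacent? : Decidable (SimpleGraph.Adj L)
  lineAdjacent? e f = ¬? (e ≟ f) ×-dec any? λ v → incident? e v ×-dec incident? f v

  stableCut⇒matchingCut : HasStableCut L → HasMatchingCut G
  stableCut⇒matchingCut (C , independent , x , y , _ , Cy , noPath) =
    side , (src x , srcx-side) , (src y , srcy-side) , crossings-disjoint
    where
    open FiniteReachability (λ e f → lineAdjacent? e f ×-dec (C f Bool.≟ false))

    Reached : Fin m → Set
    Reached = Star (AvoidingStep L C) x

    touchesReached? : ∀ v → Dec (∃[ e ] (Reached e × Incident G e v))
    touchesReached? v = any? λ e → reachable? x e ×-dec incident? e v

    side : Fin n → Bool
    side v = does (touchesReached? v)

    reached-spreads : ∀ {e f v} → C f ≡ false → Reached e →
      Incident G e v → Incident G f v → Reached f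
    reached-spreads {e} {f} {v} Cf reached ie if with e ≟ f
    ... | yes refl = reached
    ... | no e≢f   = reached ◅◅ ((e≢f , v , ie , if) , Cf) ◅ ε

    avoiding⇒same-side : ∀ e → C e ≡ false → side (src e) ≡ side (tgt e)
    avoiding⇒same-side e Ce with touchesReached? (src e) | touchesReached? (tgt e)
    ... | yes _ | yes _ = refl
    ... | no  _ | no  _ = refl
    ... | yes (f , reached , if) | no untouched =
      ⊥-elim (untouched (e , reached-spreads Ce reached if (inj₁ refl) , inj₂ refl))
    ... | no untouched | yes (f , reached , if) =
      ⊥-elim (untouched (e , reached-spreads Ce reached if (inj₂ refl) , inj₁ refl))

    crossing⇒∈C : ∀ e → Crosses G side e → C e ≡ true
    crossing⇒∈C e crosses with C e in Ce
    ... | true  = refl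
    ... | false = ⊥-elim (crosses (avoiding⇒same-side e Ce))

    srcx-side : side (src x) ≡ true
    srcx-side = dec-true (touchesReached? (src x)) (x , ε , inj₁ refl)

    srcy-side : side (src y) ≡ false
    srcy-side = dec-false (touchesReached? (src y)) λ (e , reached , ie) →
      noPath (Star⇒PathAvoiding L (reached-spreads Cy reached ie (inj₁ refl)))

    crossings-disjoint : ∀ v e f → Incident G e v → Incident G f v →
      Crosses G side e → Crosses G side f → e ≡ f
    crossings-disjoint v e f ie if ce cf with e ≟ f
    ... | yes e≡f = e≡f
    ... | no  e≢f =
      ⊥-elim (independent e f (crossing⇒∈C e ce) (crossing⇒∈C f cf) (e≢f , v , ie , if))

  matchingCut⇒stableCut : HasMatchingCut G → MinIncidence2 G → HasStableCut L
  matchingCut⇒stableCut (side , (a , sa) , (b , sb) , atMostOne) minIncidence =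
    let (ea , Cea , ia) = avoidingEdgeAt a
        (eb , Ceb , ib) = avoidingEdgeAt b
    in  C , independent , ea , eb , Cea , Ceb , separated Cea ia Ceb ib
    where
    crosses? : ∀ e → Dec (Crosses G side e)
    crosses? e = ¬? (side (src e) Bool.≟ side (tgt e))

    C : Fin m → Bool
    C e = does (crosses? e)

    ∈C⇒crossing : ∀ {e} → C e ≡ true → Crosses G side e
    ∈C⇒crossing {e} = does≡true⇒ (crosses? e)

    side-along : ∀ {e v} → C e ≡ false → Incident G e v → side (src e) ≡ side v
    side-along Ce (inj₁ refl) = refl
    side-along {e} Ce (inj₂ refl) =
      decidable-stable (side (src e) Bool.≟ side (tgt e)) (does≡false⇒¬ (crosses? e) Ce)

    independent : Independent L C
    independent e f Ce Cf (e≢f , v , ie , if) =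
      e≢f (atMostOne v e f ie if (∈C⇒crossing Ce) (∈C⇒crossing Cf))

    avoidingEdgeAt : ∀ v → ∃[ e ] (C e ≡ false × Incident G e v)
    avoidingEdgeAt v with minIncidence v
    ... | e , f , e≢f , ie , if with C e in Ce | C f in Cf
    ...   | false | _     = e , Ce , ie
    ...   | true  | false = f , Cf , if
    ...   | true  | true  =
      ⊥-elim (e≢f (atMostOne v e f ie if (∈C⇒crossing Ce) (∈C⇒crossing Cf)))

    side-along-path : ∀ {e f} → PathAvoiding L C e f → C e ≡ false →
      side (src e) ≡ side (src f)
    side-along-path = PathAvoiding-preserves L (λ e → side (src e))
      λ (_ , v , ie , if) Ce Cf → trans (side-along Ce ie) (sym (side-along Cf if))

    separated : ∀ {e f} → C e ≡ false → Incident G e a → C f ≡ false → Incident G f b →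
      ¬ PathAvoiding L C e f
    separated Ce ie Cf if path = contradiction sides-agree λ ()
      where
      open ≡-Reasoning
      sides-agree : true ≡ false
      sides-agree = begin
        true           ≡⟨ sym sa ⟩
        side a         ≡⟨ sym (side-along Ce ie) ⟩
        side (src _)   ≡⟨ side-along-path path Ce ⟩
        side (src _)   ≡⟨ side-along Cf if ⟩
        side b         ≡⟨ sb ⟩
        false          ∎

lemma2 : (G : Multigraph) →
    (HasStableCut (LineGraph G) → HasMatchingCut G) ×
    (HasMatchingCut G → MinIncidence2 G → HasStableCut (LineGraph G))
lemma2 G = stableCut⇒matchingCut G , matchingCut⇒stableCut G
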